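{- For all $u,v\in V$ with $u\ne v$, $\sum_{w\in V\setminus\{u,v\}} d_{uw}^{ -2}d_{wv}^{ -2}<12\zeta(3)+4$, where $\zeta(3)=\sum_{i=1}^\infty i^{ -3}$.
   Context: Let $n\ge 3$, $[\![n]\!]=\{0,1,\dots,n-1\}$, and let $T$ be the two-dimensional undirected torus with vertex set $V=[\![n]\!]^2$, where $(i,j)$ is adjacent to $(i,(j+1)\bmod n)$ and $((i+1)\bmod n,j)$. For $u=(x_u,y_u),v=(x_v,y_v)\in V$, $d_{uv}=\min(|x_u-x_v|,n-|x_u-x_v|)+\min(|y_u-y_v|,n-|y_u-y_v|)$. -}

module Defs where

open import Data.Nat using (ℕ; zero; suc; _⊔_; _⊓_; _∸_; ∣_-_∣)
import Data.Nat as ℕ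
open import Data.Fin using (Fin; toℕ)
open import Data.Fin.Properties using () renaming (_≟_ to _≟ᶠ_)
open import Data.Product using (_×_; _,_)
open import Data.Product.Properties using (≡-dec)
open import Data.List using (List; map; foldr; filter; allFin; cartesianProduct)
open import Data.Integer using (+_)
open import Data.Rational using (ℚ; _/_; _+_; _*_; 0ℚ)
open import Relation.Nullary using (¬_; Dec)
open import Relation.Nullary.Decidable using (¬?; _×-dec_)
open import Relation.Binary.PropositionalEquality using (_≡_)

-- Vertices of the n × n torus
V : ℕ → Set
V n = Fin n × Fin n

_≟V_ : ∀ {n} (u v : V n) → Dec (u ≡ v)
_≟V_ = ≡-dec _≟ᶠ_ _≟ᶠ_

cdist : (n : ℕ) → Fin n → Fin n → ℕ
cdist n a b = ∣ toℕ a - toℕ b ∣ ⊓ (n ∸ ∣ toℕ a - toℕ b ∣)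

d : (n : ℕ) → V n → V n → ℕ
d n (xu , yu) (xv , yv) = cdist n xu xv ℕ.+ cdist n yu yv

-- reciprocal 1/k in ℚ (value at k = 0 is irrelevant; set to 0)
inv : ℕ → ℚ
inv zero = 0ℚ
inv (suc k) = + 1 / suc k

sumℚ : List ℚ → ℚ
sumℚ = foldr _+_ 0ℚ

allV : (n : ℕ) → List (V n)
allV n = cartesianProduct (allFin n) (allFin n)

allV-minus : (n : ℕ) → V n → V n → List (V n)
allV-minus n u v = filter (λ w → ¬? (w ≟V u) ×-dec ¬? (w ≟V v)) (allV n)

S : (n : ℕ) → V n → V n → ℚ
S n u v = sumℚ (map (λ w → inv (d n u w ℕ.* d n u w ℕ.* (d n w v ℕ.* d n w v))) (allV-minus n u v))

ζ3-partial : ℕ → ℚ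
ζ3-partial zero = 0ℚ
ζ3-partial (suc N) = ζ3-partial N + inv (suc N ℕ.* suc N ℕ.* suc N)

12ℚ : ℚ
12ℚ = + 12 / 1

4ℚ : ℚ
4ℚ = + 4 / 1

module Submission where

-- By 2xy ≤ x² + y², 2 d_{uw}^{-2} d_{wv}^{-2} ≤ d_{uw}^{-4} + d_{vw}^{-4}, so it suffices to show
-- Σ_w d_{aw}^{-4} ≤ 45/4 for every vertex a (terms with d = 0 vanish, as inv 0 = 0).  Write
-- d_{aw} = c₁ + c₂ with the cyclic coordinate distances.  Away from w = a,
-- (2c₁+1)(2c₂+1) ≤ 3(c₁+c₂)² gives d^{-4} ≤ 9 h(c₁) h(c₂) with h(c) = (2c+1)^{-2}; at w = a the
-- right-hand side is 9.  The double sum of h(c₁) h(c₂) factors, and each factor Σ_x h(c(x)) is at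
-- most 1 + 1/4 + 1/4: bound h(min(p, n − p)) by h(p) + h(n − p), which after reflecting k ↦ n − k
-- becomes a sum over all k < n, and telescope with h(k) ≤ 1/(4k) − 1/(4(k+1)).

open import Defs
open import Data.Nat using (ℕ; _≥_)
open import Data.Rational using (ℚ; _<_; _+_; _*_)
open import Data.Product using (∃)
open import Relation.Binary.PropositionalEquality using (_≢_)

open import Algebra.Bundles using (CommutativeMonoid)
import Algebra.Properties.CommutativeSemigroup as CommutativeSemigroupProperties
open import Data.Bool using (true; false)
open import Data.Fin using (Fin; toℕ)
import Data.Fin.Properties as Fin
open import Data.Integer as ℤ using (+_)
open import Data.List using (List; []; _∷_; map; filter; allFin; cartesianProduct; tabulate; _++_)
import Data.List.Properties as List
open import Data.List.Membership.Propositional using (_∈_)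
open import Data.List.Membership.Propositional.Properties using (∈-allFin)
open import Data.List.Relation.Unary.Any using (here; there)
open import Data.Nat as ℕ using (zero; suc; NonZero; _⊓_; _∸_; ∣_-_∣)
import Data.Nat.Properties as ℕ
open import Data.Nat.Coprimality using (1-coprimeTo)
open import Data.Nat.Tactic.RingSolver using (solve)
open import Data.Product using (_×_; _,_; proj₁; proj₂)
open import Data.Rational as ℚ using (mkℚ; _/_; _-_; _≤_; 0ℚ; 1ℚ; toℚᵘ)
import Data.Rational.Properties as ℚ
open import Data.Rational.Solver using (module +-*-Solver)
import Data.Rational.Unnormalised as ℚᵘ
import Data.Rational.Unnormalised.Properties as ℚᵘ
open import Data.Sum using (inj₁; inj₂)
open import Function using (_∘_; id)
open import Relation.Binary.PropositionalEquality using (_≡_; refl; sym; trans; cong; cong₂; subst; subst₂; module ≡-Reasoning)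
open import Relation.Nullary.Decidable using (does; toWitness)
open import Relation.Unary using (Decidable)

open CommutativeSemigroupProperties (CommutativeMonoid.commutativeSemigroup ℚ.+-0-commutativeMonoid) using (interchange)
open +-*-Solver using (_:+_; _:-_; _:*_; _:=_; con) renaming (solve to solveℚ)

2ℚ 9ℚ : ℚ
2ℚ = + 2 / 1
9ℚ = + 9 / 1

p≤p+q : ∀ p {q} → 0ℚ ≤ q → p ≤ p + q
p≤p+q p {q} 0≤q = subst (_≤ p + q) (ℚ.+-identityʳ p) (ℚ.+-monoʳ-≤ p 0≤q)

p≤q+p : ∀ p {q} → 0ℚ ≤ q → p ≤ q + p
p≤q+p p {q} 0≤q = subst (p ≤_) (ℚ.+-comm p q) (p≤p+q p 0≤q)

f[m⊓n]≤f[m]+f[n] : ∀ (f : ℕ → ℚ) → (∀ k → 0ℚ ≤ f k) → ∀ m n → f (m ⊓ n) ≤ f m + f n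
f[m⊓n]≤f[m]+f[n] f f≥0 m n with ℕ.⊓-sel m n
... | inj₁ m⊓n≡m rewrite m⊓n≡m = p≤p+q (f m) (f≥0 n)
... | inj₂ m⊓n≡n rewrite m⊓n≡n = p≤q+p (f n) (f≥0 m)

+-cancelʳ-≤ : ∀ r {p q} → p + r ≤ q + r → p ≤ q
+-cancelʳ-≤ r {p} {q} le = subst₂ _≤_ (cancel p) (cancel q) (ℚ.+-monoˡ-≤ (ℚ.- r) le)
  where
  cancel : ∀ x → x + r - r ≡ x
  cancel x = solveℚ 2 (λ x r → (x :+ r) :- r := x) refl x r

*-mono-≤-nonNeg : ∀ {p q r s} → 0ℚ ≤ q → 0ℚ ≤ r → p ≤ r → q ≤ s → p * q ≤ r * s
*-mono-≤-nonNeg {p} {q} {r} {s} 0≤q 0≤r p≤r q≤s = ℚ.≤-trans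
  (ℚ.*-monoʳ-≤-nonNeg q {{ℚ.nonNegative 0≤q}} p≤r) (ℚ.*-monoˡ-≤-nonNeg r {{ℚ.nonNegative 0≤r}} q≤s)

p*p-nonNeg : ∀ p → 0ℚ ≤ p * p
p*p-nonNeg p with ℚ.≤-total 0ℚ p
... | inj₁ 0≤p = ℚ.nonNegative⁻¹ (p * p) {{ℚ.nonNeg*nonNeg⇒nonNeg p {{ℚ.nonNegative 0≤p}} p {{ℚ.nonNegative 0≤p}}}}
... | inj₂ p≤0 = ℚ.nonNegative⁻¹ (p * p) {{ℚ.nonPos*nonPos⇒nonPos p {{ℚ.nonPositive p≤0}} p {{ℚ.nonPositive p≤0}}}}

2pq≤p²+q² : ∀ p q → 2ℚ * (p * q) ≤ p * p + q * q
2pq≤p²+q² p q = begin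
  2ℚ * (p * q)
    ≤⟨ p≤p+q _ (p*p-nonNeg (p - q)) ⟩
  2ℚ * (p * q) + (p - q) * (p - q)
    ≡⟨ solveℚ 2 (λ p q → con 2ℚ :* (p :* q) :+ (p :- q) :* (p :- q) := p :* p :+ q :* q) refl p q ⟩
  p * p + q * q ∎
  where open ℚ.≤-Reasoning

inv-suc : ∀ k → inv (suc k) ≡ mkℚ (+ 1) k (1-coprimeTo (suc k))
inv-suc k = ℚ.normalize-coprime (1-coprimeTo (suc k))

inv-nonNeg : ∀ k → 0ℚ ≤ inv k
inv-nonNeg zero    = ℚ.≤-refl
inv-nonNeg (suc k) rewrite inv-suc k = ℚ.nonNegative⁻¹ _

inv-* : ∀ m n → inv (m ℕ.* n) ≡ inv m * inv n
inv-* zero    n       = sym (ℚ.*-zeroˡ (inv n))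
inv-* (suc m) zero    rewrite ℕ.*-zeroʳ m = sym (ℚ.*-zeroʳ (inv (suc m)))
inv-* (suc m) (suc n) rewrite inv-suc m | inv-suc n = refl

inv+inv≤inv : ∀ m n k .{{_ : NonZero m}} .{{_ : NonZero n}} .{{_ : NonZero k}} →
              (m ℕ.+ n) ℕ.* k ℕ.≤ m ℕ.* n → inv m + inv n ≤ inv k
inv+inv≤inv (suc m) (suc n) (suc k) le =
  ℚ.toℚᵘ-cancel-≤ (ℚᵘ.≤-respˡ-≃ (ℚᵘ.≃-sym (ℚ.toℚᵘ-homo-+ (inv (suc m)) (inv (suc n)))) cross)
  where
  open ℕ.≤-Reasoning
  -- ℚ normalises a sum through a gcd; in ℚᵘ it is a plain cross-multiplication.
  cross : toℚᵘ (inv (suc m)) ℚᵘ.+ toℚᵘ (inv (suc n)) ℚᵘ.≤ toℚᵘ (inv (suc k))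
  cross rewrite inv-suc m | inv-suc n | inv-suc k = ℚᵘ.*≤* (ℤ.+≤+ (begin
    (suc (n ℕ.+ 0) ℕ.+ suc (m ℕ.+ 0)) ℕ.* suc k
      ≡⟨ solve (m ∷ n ∷ k ∷ []) ⟩
    (suc m ℕ.+ suc n) ℕ.* suc k
      ≤⟨ le ⟩
    suc m ℕ.* suc n
      ≡⟨ solve (m ∷ n ∷ []) ⟩
    1 ℕ.* (suc m ℕ.* suc n) ∎))

inv-antitone : ∀ {m k} .{{_ : NonZero m}} → m ℕ.≤ k → inv k ≤ inv m
inv-antitone {suc m} {suc k} (ℕ.s≤s le) rewrite inv-suc m | inv-suc k = ℚ.*≤* (ℤ.+≤+ (ℕ.*-monoʳ-≤ 1 (ℕ.s≤s le)))

∑< : ℕ → (ℕ → ℚ) → ℚ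
∑< zero    f = 0ℚ
∑< (suc m) f = f 0 + ∑< m (f ∘ suc)

syntax ∑< m (λ i → e) = ∑[ i < m ] e

∑-cong : ∀ m {f g : ℕ → ℚ} → (∀ {i} → i ℕ.< m → f i ≡ g i) → ∑< m f ≡ ∑< m g
∑-cong zero    f≡g = refl
∑-cong (suc m) f≡g = cong₂ _+_ (f≡g (ℕ.s≤s ℕ.z≤n)) (∑-cong m (f≡g ∘ ℕ.s≤s))

∑-mono-≤ : ∀ m {f g : ℕ → ℚ} → (∀ i → f i ≤ g i) → ∑< m f ≤ ∑< m g
∑-mono-≤ zero    f≤g = ℚ.≤-refl
∑-mono-≤ (suc m) f≤g = ℚ.+-mono-≤ (f≤g 0) (∑-mono-≤ m (f≤g ∘ suc))

∑-distrib-+ : ∀ m (f g : ℕ → ℚ) → ∑[ i < m ] (f i + g i) ≡ ∑< m f + ∑< m g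
∑-distrib-+ zero    f g = refl
∑-distrib-+ (suc m) f g =
  trans (cong (_+_ (f 0 + g 0)) (∑-distrib-+ m (f ∘ suc) (g ∘ suc))) (interchange (f 0) (g 0) _ _)

∑-split : ∀ a m (f : ℕ → ℚ) → ∑< (a ℕ.+ m) f ≡ ∑< a f + ∑[ j < m ] f (a ℕ.+ j)
∑-split zero    m f = sym (ℚ.+-identityˡ _)
∑-split (suc a) m f = trans (cong (_+_ (f 0)) (∑-split a m (f ∘ suc))) (sym (ℚ.+-assoc (f 0) _ _))

∑-snoc : ∀ m (f : ℕ → ℚ) → ∑< (suc m) f ≡ ∑< m f + f m
∑-snoc zero    f = ℚ.+-comm (f 0) 0ℚ
∑-snoc (suc m) f = trans (cong (_+_ (f 0)) (∑-snoc m (f ∘ suc))) (sym (ℚ.+-assoc (f 0) _ _))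

∑-reverse : ∀ m (f : ℕ → ℚ) → ∑[ i < m ] f (m ∸ i) ≡ ∑[ i < m ] f (suc i)
∑-reverse zero    f = refl
∑-reverse (suc m) f = begin
  f (suc m) + ∑[ i < m ] f (m ∸ i)
    ≡⟨ cong (_+_ (f (suc m))) (∑-reverse m f) ⟩
  f (suc m) + ∑[ i < m ] f (suc i)
    ≡⟨ ℚ.+-comm (f (suc m)) _ ⟩
  ∑[ i < m ] f (suc i) + f (suc m)
    ≡⟨ sym (∑-snoc m (f ∘ suc)) ⟩
  ∑[ i < suc m ] f (suc i) ∎
  where open ≡-Reasoning

∑-telescope : ∀ m (f g : ℕ → ℚ) → (∀ k → f k + g (suc k) ≤ g k) → ∑< m f + g m ≤ g 0
∑-telescope zero    f g step = ℚ.≤-reflexive (ℚ.+-identityˡ (g 0))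
∑-telescope (suc m) f g step = begin
  f 0 + ∑< m (f ∘ suc) + g (suc m)
    ≡⟨ ℚ.+-assoc (f 0) _ _ ⟩
  f 0 + (∑< m (f ∘ suc) + g (suc m))
    ≤⟨ ℚ.+-monoʳ-≤ (f 0) (∑-telescope m (f ∘ suc) (g ∘ suc) (step ∘ suc)) ⟩
  f 0 + g 1
    ≤⟨ step 0 ⟩
  g 0 ∎
  where open ℚ.≤-Reasoning

m∸[n∸o]≡m∸n+o : ∀ {m n o} → o ℕ.≤ n → n ℕ.≤ m → m ∸ (n ∸ o) ≡ m ∸ n ℕ.+ o
m∸[n∸o]≡m∸n+o {m} {n} {o} o≤n n≤m = begin
  m ∸ (n ∸ o)
    ≡⟨ cong (_∸ (n ∸ o)) (sym (ℕ.m∸n+n≡m n≤m)) ⟩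
  m ∸ n ℕ.+ n ∸ (n ∸ o)
    ≡⟨ ℕ.+-∸-assoc (m ∸ n) (ℕ.m∸n≤m n o) ⟩
  m ∸ n ℕ.+ (n ∸ (n ∸ o))
    ≡⟨ cong (m ∸ n ℕ.+_) (ℕ.m∸[m∸n]≡n o≤n) ⟩
  m ∸ n ℕ.+ o ∎
  where open ≡-Reasoning

-- The terms F (a ∸ i) with i < a are reflected to F (n ∸ a + i), filling the range of k
-- that the terms with i ≥ a, namely F (i ∸ a), leave out.
∑-∣a-i∣≡∑ : ∀ {a n} (F : ℕ → ℚ) → a ℕ.≤ n → (∀ {k} → k ℕ.≤ a → F (n ∸ k) ≡ F k) →
          ∑[ i < n ] F ∣ a - i ∣ ≡ ∑< n F
∑-∣a-i∣≡∑ {a} {n} F a≤n F-reflect = begin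
  ∑[ i < n ] F ∣ a - i ∣
    ≡⟨ cong (λ l → ∑[ i < l ] F ∣ a - i ∣) (sym (ℕ.m+[n∸m]≡n a≤n)) ⟩
  ∑[ i < a ℕ.+ m ] F ∣ a - i ∣
    ≡⟨ ∑-split a m _ ⟩
  ∑[ i < a ] F ∣ a - i ∣ + ∑[ j < m ] F ∣ a - a ℕ.+ j ∣
    ≡⟨ cong₂ _+_ (∑-cong a below) (∑-cong m λ {j} _ → cong F (ℕ.∣m-m+n∣≡n a j)) ⟩
  ∑[ i < a ] F (m ℕ.+ i) + ∑< m F
    ≡⟨ ℚ.+-comm (∑[ i < a ] F (m ℕ.+ i)) _ ⟩
  ∑< m F + ∑[ i < a ] F (m ℕ.+ i)
    ≡⟨ sym (∑-split m a F) ⟩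
  ∑< (m ℕ.+ a) F
    ≡⟨ cong (λ l → ∑< l F) (ℕ.m∸n+n≡m a≤n) ⟩
  ∑< n F ∎
  where
  open ≡-Reasoning
  m : ℕ
  m = n ∸ a
  below : ∀ {i} → i ℕ.< a → F ∣ a - i ∣ ≡ F (m ℕ.+ i)
  below {i} i<a = begin
    F ∣ a - i ∣
      ≡⟨ cong F (ℕ.m≤n⇒∣n-m∣≡n∸m (ℕ.<⇒≤ i<a)) ⟩
    F (a ∸ i)
      ≡⟨ sym (F-reflect (ℕ.m∸n≤m a i)) ⟩
    F (n ∸ (a ∸ i))
      ≡⟨ cong F (m∸[n∸o]≡m∸n+o (ℕ.<⇒≤ i<a) a≤n) ⟩
    F (m ℕ.+ i) ∎

sumOver : ∀ {A : Set} → (A → ℚ) → List A → ℚ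
sumOver f xs = sumℚ (map f xs)

module _ {A : Set} where

  sumOver-cong : ∀ {f g : A → ℚ} xs → (∀ x → f x ≡ g x) → sumOver f xs ≡ sumOver g xs
  sumOver-cong []       f≡g = refl
  sumOver-cong (x ∷ xs) f≡g = cong₂ _+_ (f≡g x) (sumOver-cong xs f≡g)

  sumOver-mono-≤ : ∀ {f g : A → ℚ} xs → (∀ x → f x ≤ g x) → sumOver f xs ≤ sumOver g xs
  sumOver-mono-≤ []       f≤g = ℚ.≤-refl
  sumOver-mono-≤ (x ∷ xs) f≤g = ℚ.+-mono-≤ (f≤g x) (sumOver-mono-≤ xs f≤g)

  sumOver-nonNeg : ∀ {f : A → ℚ} xs → (∀ x → 0ℚ ≤ f x) → 0ℚ ≤ sumOver f xs
  sumOver-nonNeg []       f≥0 = ℚ.≤-refl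
  sumOver-nonNeg (x ∷ xs) f≥0 = ℚ.+-mono-≤ (f≥0 x) (sumOver-nonNeg xs f≥0)

  sumOver-distrib-+ : ∀ (f g : A → ℚ) xs → sumOver (λ x → f x + g x) xs ≡ sumOver f xs + sumOver g xs
  sumOver-distrib-+ f g []       = refl
  sumOver-distrib-+ f g (x ∷ xs) =
    trans (cong (_+_ (f x + g x)) (sumOver-distrib-+ f g xs)) (interchange (f x) (g x) _ _)

  sumOver-*ˡ : ∀ c (f : A → ℚ) xs → sumOver (λ x → c * f x) xs ≡ c * sumOver f xs
  sumOver-*ˡ c f []       = sym (ℚ.*-zeroʳ c)
  sumOver-*ˡ c f (x ∷ xs) =
    trans (cong (_+_ (c * f x)) (sumOver-*ˡ c f xs)) (sym (ℚ.*-distribˡ-+ c (f x) _))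

  sumOver-++ : ∀ (f : A → ℚ) xs ys → sumOver f (xs ++ ys) ≡ sumOver f xs + sumOver f ys
  sumOver-++ f []       ys = sym (ℚ.+-identityˡ _)
  sumOver-++ f (x ∷ xs) ys = trans (cong (_+_ (f x)) (sumOver-++ f xs ys)) (sym (ℚ.+-assoc (f x) _ _))

  sumOver-filter-≤ : ∀ {P : A → Set} (P? : Decidable P) {f : A → ℚ} xs →
                     (∀ x → 0ℚ ≤ f x) → sumOver f (filter P? xs) ≤ sumOver f xs
  sumOver-filter-≤ P? []       f≥0 = ℚ.≤-refl
  sumOver-filter-≤ P? {f} (x ∷ xs) f≥0 with does (P? x)
  ... | true  = ℚ.+-monoʳ-≤ (f x) (sumOver-filter-≤ P? xs f≥0)
  ... | false = ℚ.≤-trans (sumOver-filter-≤ P? xs f≥0) (p≤q+p _ (f≥0 x))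

  ∈⇒≤-sumOver : ∀ {f : A → ℚ} {x} xs → (∀ y → 0ℚ ≤ f y) → x ∈ xs → f x ≤ sumOver f xs
  ∈⇒≤-sumOver (y ∷ xs) f≥0 (here refl)  = p≤p+q _ (sumOver-nonNeg xs f≥0)
  ∈⇒≤-sumOver (y ∷ xs) f≥0 (there x∈xs) = ℚ.≤-trans (∈⇒≤-sumOver xs f≥0 x∈xs) (p≤q+p _ (f≥0 y))

sumOver-map : ∀ {A B : Set} (f : B → ℚ) (g : A → B) xs → sumOver f (map g xs) ≡ sumOver (f ∘ g) xs
sumOver-map f g xs = cong sumℚ (sym (List.map-∘ xs))

sumOver-cartesianProduct : ∀ {A B : Set} (f : A → ℚ) (g : B → ℚ) xs ys →
  sumOver (λ w → f (proj₁ w) * g (proj₂ w)) (cartesianProduct xs ys) ≡ sumOver f xs * sumOver g ys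
sumOver-cartesianProduct f g []       ys = sym (ℚ.*-zeroˡ (sumOver g ys))
sumOver-cartesianProduct {A} {B} f g (x ∷ xs) ys = begin
  sumOver fg (map (x ,_) ys ++ cartesianProduct xs ys)
    ≡⟨ sumOver-++ fg (map (x ,_) ys) _ ⟩
  sumOver fg (map (x ,_) ys) + sumOver fg (cartesianProduct xs ys)
    ≡⟨ cong₂ _+_ (trans (sumOver-map fg (x ,_) ys) (sumOver-*ˡ (f x) g ys))
                 (sumOver-cartesianProduct f g xs ys) ⟩
  f x * sumOver g ys + sumOver f xs * sumOver g ys
    ≡⟨ sym (ℚ.*-distribʳ-+ (sumOver g ys) (f x) _) ⟩
  (f x + sumOver f xs) * sumOver g ys ∎
  where
  open ≡-Reasoning
  fg : A × B → ℚ
  fg w = f (proj₁ w) * g (proj₂ w)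

sumOver-allFin : ∀ n (f : ℕ → ℚ) → sumOver (f ∘ toℕ) (allFin n) ≡ ∑< n f
sumOver-allFin n f = trans (cong sumℚ (List.map-tabulate {n = n} id (f ∘ toℕ))) (sum-tabulate n f)
  where
  sum-tabulate : ∀ n (f : ℕ → ℚ) → sumℚ (tabulate {n = n} (f ∘ toℕ)) ≡ ∑< n f
  sum-tabulate zero    f = refl
  sum-tabulate (suc n) f = cong (_+_ (f 0)) (sum-tabulate n (f ∘ suc))

invOddSq : ℕ → ℚ
invOddSq c = inv (suc (2 ℕ.* c) ℕ.* suc (2 ℕ.* c))

invOddSq-nonNeg : ∀ c → 0ℚ ≤ invOddSq c
invOddSq-nonNeg c = inv-nonNeg (suc (2 ℕ.* c) ℕ.* suc (2 ℕ.* c))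

invOddSq-telescopes : ∀ k → invOddSq (suc k) + inv (4 ℕ.* suc (suc k)) ≤ inv (4 ℕ.* suc k)
invOddSq-telescopes k = inv+inv≤inv (suc (2 ℕ.* suc k) ℕ.* suc (2 ℕ.* suc k)) (4 ℕ.* suc (suc k)) (4 ℕ.* suc k) (begin
  (suc (2 ℕ.* suc k) ℕ.* suc (2 ℕ.* suc k) ℕ.+ 4 ℕ.* suc (suc k)) ℕ.* (4 ℕ.* suc k)
    ≤⟨ ℕ.m≤m+n _ 4 ⟩
  (suc (2 ℕ.* suc k) ℕ.* suc (2 ℕ.* suc k) ℕ.+ 4 ℕ.* suc (suc k)) ℕ.* (4 ℕ.* suc k) ℕ.+ 4
    ≡⟨ solve (k ∷ []) ⟩
  suc (2 ℕ.* suc k) ℕ.* suc (2 ℕ.* suc k) ℕ.* (4 ℕ.* suc (suc k)) ∎)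
  where open ℕ.≤-Reasoning

∑-invOddSq-suc≤¼ : ∀ m → ∑[ k < m ] invOddSq (suc k) ≤ inv 4
∑-invOddSq-suc≤¼ m = begin
  ∑[ k < m ] invOddSq (suc k)
    ≤⟨ p≤p+q _ (inv-nonNeg (4 ℕ.* suc m)) ⟩
  ∑[ k < m ] invOddSq (suc k) + inv (4 ℕ.* suc m)
    ≤⟨ ∑-telescope m _ (λ k → inv (4 ℕ.* suc k)) invOddSq-telescopes ⟩
  inv 4 ∎
  where open ℚ.≤-Reasoning

∑-invOddSq-reflected≤3/2 : ∀ n → ∑[ k < n ] (invOddSq k + invOddSq (n ∸ k)) ≤ + 3 / 2
∑-invOddSq-reflected≤3/2 zero    = ℚ.nonNegative⁻¹ (+ 3 / 2)
∑-invOddSq-reflected≤3/2 (suc m) = begin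
  ∑[ k < suc m ] (invOddSq k + invOddSq (suc m ∸ k))
    ≡⟨ ∑-distrib-+ (suc m) invOddSq (λ k → invOddSq (suc m ∸ k)) ⟩
  ∑< (suc m) invOddSq + ∑[ k < suc m ] invOddSq (suc m ∸ k)
    ≡⟨ cong (_+_ (∑< (suc m) invOddSq)) (∑-reverse (suc m) invOddSq) ⟩
  invOddSq 0 + ∑[ k < m ] invOddSq (suc k) + ∑[ k < suc m ] invOddSq (suc k)
    ≤⟨ ℚ.+-mono-≤ (ℚ.+-monoʳ-≤ (invOddSq 0) (∑-invOddSq-suc≤¼ m)) (∑-invOddSq-suc≤¼ (suc m)) ⟩
  invOddSq 0 + inv 4 + inv 4
    ≡⟨⟩
  + 3 / 2 ∎
  where open ℚ.≤-Reasoning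

∑-invOddSq-cyclic≤3/2 : ∀ {a n} → a ℕ.≤ n → ∑[ i < n ] invOddSq (∣ a - i ∣ ⊓ (n ∸ ∣ a - i ∣)) ≤ + 3 / 2
∑-invOddSq-cyclic≤3/2 {a} {n} a≤n = begin
  ∑[ i < n ] invOddSq (∣ a - i ∣ ⊓ (n ∸ ∣ a - i ∣))
    ≤⟨ ∑-mono-≤ n (λ i → f[m⊓n]≤f[m]+f[n] invOddSq invOddSq-nonNeg ∣ a - i ∣ _) ⟩
  ∑[ i < n ] K ∣ a - i ∣
    ≡⟨ ∑-∣a-i∣≡∑ K a≤n K-reflect ⟩
  ∑< n K
    ≤⟨ ∑-invOddSq-reflected≤3/2 n ⟩
  + 3 / 2 ∎
  where
  open ℚ.≤-Reasoning
  K : ℕ → ℚ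
  K k = invOddSq k + invOddSq (n ∸ k)
  K-reflect : ∀ {k} → k ℕ.≤ a → K (n ∸ k) ≡ K k
  K-reflect {k} k≤a rewrite ℕ.m∸[m∸n]≡n (ℕ.≤-trans k≤a a≤n) = ℚ.+-comm (invOddSq (n ∸ k)) (invOddSq k)

inv⁴ : ℕ → ℚ
inv⁴ k = inv (k ℕ.* k ℕ.* (k ℕ.* k))

2inv[m²n²]≤inv⁴m+inv⁴n : ∀ m n → 2ℚ * inv (m ℕ.* m ℕ.* (n ℕ.* n)) ≤ inv⁴ m + inv⁴ n
2inv[m²n²]≤inv⁴m+inv⁴n m n
  rewrite inv-* (m ℕ.* m) (n ℕ.* n) | inv-* (m ℕ.* m) (m ℕ.* m) | inv-* (n ℕ.* n) (n ℕ.* n)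
  = 2pq≤p²+q² (inv (m ℕ.* m)) (inv (n ℕ.* n))

[2a+1][2b+1]≤3[a+b]² : ∀ a b .{{_ : NonZero (a ℕ.+ b)}} →
                       suc (2 ℕ.* a) ℕ.* suc (2 ℕ.* b) ℕ.≤ 3 ℕ.* ((a ℕ.+ b) ℕ.* (a ℕ.+ b))
[2a+1][2b+1]≤3[a+b]² (suc a) b = begin
  suc (2 ℕ.* suc a) ℕ.* suc (2 ℕ.* b)
    ≤⟨ ℕ.m≤m+n _ (3 ℕ.* a ℕ.* a ℕ.+ 3 ℕ.* b ℕ.* b ℕ.+ 4 ℕ.* a ℕ.+ 2 ℕ.* a ℕ.* b) ⟩
  suc (2 ℕ.* suc a) ℕ.* suc (2 ℕ.* b) ℕ.+ (3 ℕ.* a ℕ.* a ℕ.+ 3 ℕ.* b ℕ.* b ℕ.+ 4 ℕ.* a ℕ.+ 2 ℕ.* a ℕ.* b)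
    ≡⟨ solve (a ∷ b ∷ []) ⟩
  3 ℕ.* ((suc a ℕ.+ b) ℕ.* (suc a ℕ.+ b)) ∎
  where open ℕ.≤-Reasoning
[2a+1][2b+1]≤3[a+b]² zero (suc b) = begin
  suc (2 ℕ.* 0) ℕ.* suc (2 ℕ.* suc b)
    ≤⟨ ℕ.m≤m+n _ (3 ℕ.* b ℕ.* b ℕ.+ 4 ℕ.* b) ⟩
  suc (2 ℕ.* 0) ℕ.* suc (2 ℕ.* suc b) ℕ.+ (3 ℕ.* b ℕ.* b ℕ.+ 4 ℕ.* b)
    ≡⟨ solve (b ∷ []) ⟩
  3 ℕ.* (suc b ℕ.* suc b) ∎
  where open ℕ.≤-Reasoning

[2a+1]²[2b+1]²≤9[a+b]⁴ : ∀ a b .{{_ : NonZero (a ℕ.+ b)}} →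
  suc (2 ℕ.* a) ℕ.* suc (2 ℕ.* a) ℕ.* (suc (2 ℕ.* b) ℕ.* suc (2 ℕ.* b))
    ℕ.≤ 9 ℕ.* ((a ℕ.+ b) ℕ.* (a ℕ.+ b) ℕ.* ((a ℕ.+ b) ℕ.* (a ℕ.+ b)))
[2a+1]²[2b+1]²≤9[a+b]⁴ a b = begin
  suc (2 ℕ.* a) ℕ.* suc (2 ℕ.* a) ℕ.* (suc (2 ℕ.* b) ℕ.* suc (2 ℕ.* b))
    ≡⟨ solve (a ∷ b ∷ []) ⟩
  suc (2 ℕ.* a) ℕ.* suc (2 ℕ.* b) ℕ.* (suc (2 ℕ.* a) ℕ.* suc (2 ℕ.* b))
    ≤⟨ ℕ.*-mono-≤ ([2a+1][2b+1]≤3[a+b]² a b) ([2a+1][2b+1]≤3[a+b]² a b) ⟩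
  3 ℕ.* ((a ℕ.+ b) ℕ.* (a ℕ.+ b)) ℕ.* (3 ℕ.* ((a ℕ.+ b) ℕ.* (a ℕ.+ b)))
    ≡⟨ solve (a ∷ b ∷ []) ⟩
  9 ℕ.* ((a ℕ.+ b) ℕ.* (a ℕ.+ b) ℕ.* ((a ℕ.+ b) ℕ.* (a ℕ.+ b))) ∎
  where open ℕ.≤-Reasoning

inv≡9*inv[9*] : ∀ m → inv m ≡ 9ℚ * inv (9 ℕ.* m)
inv≡9*inv[9*] m = begin
  inv m
    ≡⟨ sym (ℚ.*-identityˡ (inv m)) ⟩
  9ℚ * inv 9 * inv m
    ≡⟨ ℚ.*-assoc 9ℚ (inv 9) (inv m) ⟩
  9ℚ * (inv 9 * inv m)
    ≡⟨ cong (_*_ 9ℚ) (sym (inv-* 9 m)) ⟩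
  9ℚ * inv (9 ℕ.* m) ∎
  where open ≡-Reasoning

inv⁴[a+b]≤9*invOddSq*invOddSq : ∀ a b .{{_ : NonZero (a ℕ.+ b)}} →
                                inv⁴ (a ℕ.+ b) ≤ 9ℚ * (invOddSq a * invOddSq b)
inv⁴[a+b]≤9*invOddSq*invOddSq a b = begin
  inv⁴ (a ℕ.+ b)
    ≡⟨ inv≡9*inv[9*] ((a ℕ.+ b) ℕ.* (a ℕ.+ b) ℕ.* ((a ℕ.+ b) ℕ.* (a ℕ.+ b))) ⟩
  9ℚ * inv (9 ℕ.* ((a ℕ.+ b) ℕ.* (a ℕ.+ b) ℕ.* ((a ℕ.+ b) ℕ.* (a ℕ.+ b))))
    ≤⟨ ℚ.*-monoˡ-≤-nonNeg 9ℚ (inv-antitone ([2a+1]²[2b+1]²≤9[a+b]⁴ a b)) ⟩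
  9ℚ * inv (suc (2 ℕ.* a) ℕ.* suc (2 ℕ.* a) ℕ.* (suc (2 ℕ.* b) ℕ.* suc (2 ℕ.* b)))
    ≡⟨ cong (_*_ 9ℚ) (inv-* (suc (2 ℕ.* a) ℕ.* suc (2 ℕ.* a)) (suc (2 ℕ.* b) ℕ.* suc (2 ℕ.* b))) ⟩
  9ℚ * (invOddSq a * invOddSq b) ∎
  where open ℚ.≤-Reasoning

δ₀ : ℕ → ℚ
δ₀ zero    = 1ℚ
δ₀ (suc _) = 0ℚ

δ₀-nonNeg : ∀ c → 0ℚ ≤ δ₀ c
δ₀-nonNeg zero    = ℚ.nonNegative⁻¹ 1ℚ
δ₀-nonNeg (suc c) = ℚ.≤-refl

inv⁴[a+b]+9δ₀δ₀≤9*invOddSq*invOddSq : ∀ a b →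
  inv⁴ (a ℕ.+ b) + 9ℚ * (δ₀ a * δ₀ b) ≤ 9ℚ * (invOddSq a * invOddSq b)
inv⁴[a+b]+9δ₀δ₀≤9*invOddSq*invOddSq zero    zero    = ℚ.≤-refl
inv⁴[a+b]+9δ₀δ₀≤9*invOddSq*invOddSq (suc a) b
  rewrite ℚ.*-zeroˡ (δ₀ b) | ℚ.+-identityʳ (inv⁴ (suc a ℕ.+ b)) = inv⁴[a+b]≤9*invOddSq*invOddSq (suc a) b
inv⁴[a+b]+9δ₀δ₀≤9*invOddSq*invOddSq zero    (suc b)
  rewrite ℚ.+-identityʳ (inv⁴ (suc b)) = inv⁴[a+b]≤9*invOddSq*invOddSq zero (suc b)

cdist-comm : ∀ n (a b : Fin n) → cdist n a b ≡ cdist n b a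
cdist-comm n a b rewrite ℕ.∣-∣-comm (toℕ a) (toℕ b) = refl

d-comm : ∀ n (u v : V n) → d n u v ≡ d n v u
d-comm n (xu , yu) (xv , yv) = cong₂ ℕ._+_ (cdist-comm n xu xv) (cdist-comm n yu yv)

∑-invOddSq-cdist≤3/2 : ∀ n (a : Fin n) → sumOver (λ x → invOddSq (cdist n a x)) (allFin n) ≤ + 3 / 2
∑-invOddSq-cdist≤3/2 n a =
  subst (_≤ + 3 / 2) (sym (sumOver-allFin n _)) (∑-invOddSq-cyclic≤3/2 (ℕ.<⇒≤ (Fin.toℕ<n a)))

1≤∑-δ₀-cdist : ∀ n (a : Fin n) → 1ℚ ≤ sumOver (λ x → δ₀ (cdist n a x)) (allFin n)
1≤∑-δ₀-cdist n a = subst (_≤ sumOver (δ₀ ∘ cdist n a) (allFin n)) δ₀[cdist-a-a]≡1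
  (∈⇒≤-sumOver (allFin n) (δ₀-nonNeg ∘ cdist n a) (∈-allFin a))
  where
  δ₀[cdist-a-a]≡1 : δ₀ (cdist n a a) ≡ 1ℚ
  δ₀[cdist-a-a]≡1 rewrite ℕ.∣n-n∣≡0 (toℕ a) = refl

∑-inv⁴-d≤45/4 : ∀ n (a : V n) → sumOver (inv⁴ ∘ d n a) (allV n) ≤ + 45 / 4
∑-inv⁴-d≤45/4 n (ax , ay) = +-cancelʳ-≤ 9ℚ (begin
  E + 9ℚ
    ≤⟨ ℚ.+-monoʳ-≤ E (ℚ.*-monoˡ-≤-nonNeg 9ℚ 1≤Δ²) ⟩
  E + 9ℚ * (sumOver Δx (allFin n) * sumOver Δy (allFin n))
    ≡⟨ sym split ⟩
  sumOver (λ w → inv⁴ (d n (ax , ay) w) + 9ℚ * (Δx (proj₁ w) * Δy (proj₂ w))) (allV n)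
    ≤⟨ sumOver-mono-≤ (allV n) (λ (x , y) → inv⁴[a+b]+9δ₀δ₀≤9*invOddSq*invOddSq (cdist n ax x) (cdist n ay y)) ⟩
  sumOver (λ w → 9ℚ * (Hx (proj₁ w) * Hy (proj₂ w))) (allV n)
    ≡⟨ trans (sumOver-*ˡ 9ℚ _ (allV n)) (cong (_*_ 9ℚ) (sumOver-cartesianProduct Hx Hy (allFin n) (allFin n))) ⟩
  9ℚ * (sumOver Hx (allFin n) * sumOver Hy (allFin n))
    ≤⟨ ℚ.*-monoˡ-≤-nonNeg 9ℚ H²≤9/4 ⟩
  9ℚ * ((+ 3 / 2) * (+ 3 / 2))
    ≡⟨⟩
  + 45 / 4 + 9ℚ ∎)
  where
  open ℚ.≤-Reasoning
  E : ℚ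
  E = sumOver (inv⁴ ∘ d n (ax , ay)) (allV n)
  Hx Hy Δx Δy : Fin n → ℚ
  Hx x = invOddSq (cdist n ax x)
  Hy y = invOddSq (cdist n ay y)
  Δx x = δ₀ (cdist n ax x)
  Δy y = δ₀ (cdist n ay y)
  split : sumOver (λ w → inv⁴ (d n (ax , ay) w) + 9ℚ * (Δx (proj₁ w) * Δy (proj₂ w))) (allV n)
        ≡ E + 9ℚ * (sumOver Δx (allFin n) * sumOver Δy (allFin n))
  split = trans (sumOver-distrib-+ _ _ (allV n))
    (cong (_+_ E) (trans (sumOver-*ˡ 9ℚ _ (allV n)) (cong (_*_ 9ℚ) (sumOver-cartesianProduct Δx Δy (allFin n) (allFin n)))))
  1≤Δ² : 1ℚ ≤ sumOver Δx (allFin n) * sumOver Δy (allFin n)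
  1≤Δ² = *-mono-≤-nonNeg (ℚ.nonNegative⁻¹ 1ℚ) (sumOver-nonNeg (allFin n) (δ₀-nonNeg ∘ cdist n ax))
           (1≤∑-δ₀-cdist n ax) (1≤∑-δ₀-cdist n ay)
  H²≤9/4 : sumOver Hx (allFin n) * sumOver Hy (allFin n) ≤ (+ 3 / 2) * (+ 3 / 2)
  H²≤9/4 = *-mono-≤-nonNeg (sumOver-nonNeg (allFin n) (invOddSq-nonNeg ∘ cdist n ay)) (ℚ.nonNegative⁻¹ (+ 3 / 2))
             (∑-invOddSq-cdist≤3/2 n ax) (∑-invOddSq-cdist≤3/2 n ay)

2S≤∑inv⁴[d-u]+∑inv⁴[d-v] : ∀ n (u v : V n) →
  2ℚ * S n u v ≤ sumOver (inv⁴ ∘ d n u) (allV n) + sumOver (inv⁴ ∘ d n v) (allV n)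
2S≤∑inv⁴[d-u]+∑inv⁴[d-v] n u v = begin
  2ℚ * S n u v
    ≤⟨ ℚ.*-monoˡ-≤-nonNeg 2ℚ (sumOver-filter-≤ _ (allV n) (inv-nonNeg ∘ d²d²)) ⟩
  2ℚ * sumOver (inv ∘ d²d²) (allV n)
    ≡⟨ sym (sumOver-*ˡ 2ℚ (inv ∘ d²d²) (allV n)) ⟩
  sumOver (λ w → 2ℚ * inv (d²d² w)) (allV n)
    ≤⟨ sumOver-mono-≤ (allV n) (λ w → 2inv[m²n²]≤inv⁴m+inv⁴n (d n u w) (d n w v)) ⟩
  sumOver (λ w → inv⁴ (d n u w) + inv⁴ (d n w v)) (allV n)
    ≡⟨ sumOver-distrib-+ (inv⁴ ∘ d n u) _ (allV n) ⟩
  sumOver (inv⁴ ∘ d n u) (allV n) + sumOver (λ w → inv⁴ (d n w v)) (allV n)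
    ≡⟨ cong (_+_ (sumOver (inv⁴ ∘ d n u) (allV n))) (sumOver-cong (allV n) (λ w → cong inv⁴ (d-comm n w v))) ⟩
  sumOver (inv⁴ ∘ d n u) (allV n) + sumOver (inv⁴ ∘ d n v) (allV n) ∎
  where
  open ℚ.≤-Reasoning
  d²d² : V n → ℕ
  d²d² w = d n u w ℕ.* d n u w ℕ.* (d n w v ℕ.* d n w v)

lemma11 : (n : ℕ) → n ≥ 3 → (u v : V n) → u ≢ v →
          ∃ λ N → S n u v < (12ℚ * ζ3-partial N + 4ℚ)
lemma11 n _ u v _ = 1 , ℚ.*-cancelˡ-<-nonNeg 2ℚ (begin-strict
  2ℚ * S n u v
    ≤⟨ 2S≤∑inv⁴[d-u]+∑inv⁴[d-v] n u v ⟩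
  sumOver (inv⁴ ∘ d n u) (allV n) + sumOver (inv⁴ ∘ d n v) (allV n)
    ≤⟨ ℚ.+-mono-≤ (∑-inv⁴-d≤45/4 n u) (∑-inv⁴-d≤45/4 n v) ⟩
  + 45 / 4 + + 45 / 4
    <⟨ toWitness {a? = _ ℚ.<? _} _ ⟩
  2ℚ * (12ℚ * ζ3-partial 1 + 4ℚ) ∎)
  where open ℚ.≤-Reasoning
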